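{- Let $F$ be a fork with point of return $r$, and let $v_1\prec\dots\prec v_{n-1}$ be the unique acyclic ordering of $F\setminus\{r\}$. For $j\le n-1$ let $\mathbf w_j=[v_1,\dots,v_j]$ and $F^j=\mu_{\mathbf w_j}(F)$. Then $F^j\setminus\{v_j\}$ has the unique acyclic ordering $r\prec v_{j+1}\prec\dots\prec v_{n-1}\prec v_1\prec\dots\prec v_{j-1}$, and $F^j\setminus\{r\}$ has the unique acyclic ordering $v_{j+1}\prec\dots\prec v_{n-1}\prec v_1\prec\dots\prec v_{j-1}\prec v_j$.
   Context: A quiver is a finite directed multigraph without loops or 2-cycles; $f_{ij}$ is the number of arrows $i\to j$, taken negative if arrows go $j\to i$. Mutation at $k$: add an arrow $a\to b$ for each path $a\to k\to b$, reverse all arrows at $k$, remove 2-cycles; $\mu_{[i_1,\dots,i_m]}$ mutates at $i_1$ first, then $i_2$, etc. $F\setminus V$ denotes the full subquiver on the vertices not in $V$. Abundant: at least two arrows between every pair of distinct vertices; acyclic: no directed cycle. An acyclic ordering is a total order $\prec$ with $v_i\prec v_j$ whenever there is an arrow $v_i\to v_j$. A fork is an abundant, non-acyclic quiver $F$ with a vertex $r$ (point of return) such that for all $i\in F^-(r)$ (vertices with arrows to $r$) and $j\in F^+(r)$ (vertices with arrows from $r$), $f_{ji}>f_{ir}$ and $f_{ji}>f_{rj}$, and $F\setminus\{r\}$ is acyclic. -}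

module Defs where

open import Data.Nat as ℕ using (ℕ; suc)
open import Data.Integer as ℤ using (ℤ; _+_; _-_; _*_; -_; _⊔_; _<_; _≤_; ∣_∣; +_; 0ℤ)
open import Data.Fin using (Fin; _≟_)
import Data.Fin as Fin
open import Data.List using (List; []; _∷_; length; lookup)
open import Data.List.Membership.Propositional using (_∈_)
open import Data.List.Relation.Unary.Unique.Propositional using (Unique)
open import Data.Product using (_×_; ∃)
open import Relation.Binary.PropositionalEquality using (_≡_; _≢_)
open import Relation.Nullary using (¬_; yes; no)

-- A quiver on the vertex set Fin N, given by its arrow-count matrix:
-- f i j = number of arrows i → j, negative if the arrows go j → i.
Quiver : ℕ → Set
Quiver N = Fin N → Fin N → ℤ

-- No loops / no 2-cycles is encoded by skew-symmetry of the matrix.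
IsQuiver : ∀ {N} → Quiver N → Set
IsQuiver f = ∀ i j → f i j ≡ - f j i

pos : ℤ → ℤ
pos x = x ⊔ 0ℤ

-- Mutation at k: for a,b ≠ k add one arrow a → b per path a → k → b
-- (pos (f a k) * pos (f k b) of them), then cancel 2-cycles (net count);
-- arrows at k are reversed.
μ : ∀ {N} → Fin N → Quiver N → Quiver N
μ k f a b with a ≟ k | b ≟ k
... | yes _ | _     = - f a b
... | no _  | yes _ = - f a b
... | no _  | no _  = f a b + pos (f a k) * pos (f k b) - pos (f b k) * pos (f k a)

μs : ∀ {N} → List (Fin N) → Quiver N → Quiver N
μs []       f = f
μs (k ∷ ks) f = μs ks (μ k f)

-- Full subquiver F ∖ {r}: all arrows incident to r are deleted
-- (r remains only as an isolated vertex, irrelevant for cycles).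
_∖_ : ∀ {N} → Quiver N → Fin N → Quiver N
(f ∖ r) a b with a ≟ r | b ≟ r
... | yes _ | _     = 0ℤ
... | no _  | yes _ = 0ℤ
... | no _  | no _  = f a b

data Path {N} (f : Quiver N) : Fin N → Fin N → Set where
  edge : ∀ {a b} → 0ℤ < f a b → Path f a b
  step : ∀ {a b c} → 0ℤ < f a b → Path f b c → Path f a c

Acyclic : ∀ {N} → Quiver N → Set
Acyclic f = ¬ (∃ λ a → Path f a a)

Abundant : ∀ {N} → Quiver N → Set
Abundant f = ∀ i j → i ≢ j → 2 ℕ.≤ ∣ f i j ∣

IsFork : ∀ {N} → Quiver N → Fin N → Set
IsFork f r =
  IsQuiver f × Abundant f × ¬ Acyclic f ×
  (∀ i j → 0ℤ < f i r → 0ℤ < f r j → (f i r < f j i) × (f r j < f j i)) ×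
  Acyclic (f ∖ r)

IsAcyclicOrdering : ∀ {N} → Quiver N → Fin N → List (Fin N) → Set
IsAcyclicOrdering f x L =
  Unique L ×
  (∀ y → y ∈ L → y ≢ x) ×
  (∀ y → y ≢ x → y ∈ L) ×
  (∀ (p q : Fin (length L)) → 0ℤ < f (lookup L p) (lookup L q) → p Fin.< q)

IsUniqueAcyclicOrdering : ∀ {N} → Quiver N → Fin N → List (Fin N) → Set
IsUniqueAcyclicOrdering f x L =
  IsAcyclicOrdering f x L × (∀ L′ → IsAcyclicOrdering f x L′ → L′ ≡ L)

-- Abundance turns the acyclic ordering v₁ ≺ … ≺ vₙ₋₁ of F ∖ {r} into a chain with at
-- least two arrows vᵢ → vⱼ for all i < j. Mutating at the source of such a chain only
-- reverses the arrows at that vertex, so it moves to the end of the chain. For r we keep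
-- the invariant: after mutating along v₁, …, vⱼ, there are arrows from r to every vertex
-- other than vⱼ, and the arrows vⱼ → r are fewer than the paths r → vⱼ₊₁ → vⱼ. Mutating
-- at vⱼ₊₁ then only adds arrows r → y for the other y, turns vⱼ → r around, and
-- re-establishes the inequality for vⱼ₊₁. The first step starts from r → v₁ (otherwise r
-- would be a sink and F acyclic) and uses the fork inequalities instead. So r is a source
-- of F^j ∖ {vⱼ}, and both orderings are read off the chain.
module Submission where

open import Defs
open import Data.Nat as ℕ using (ℕ; suc)
open import Data.Integer using (ℤ; _+_; _-_; _*_; -_; _<_; _≤_; +_; +[1+_]; -[1+_]; 0ℤ; 1ℤ; +≤+; +<+)
open import Data.Integer.Properties hiding (_≟_)
open import Data.Integer.Tactic.RingSolver using (solve-∀)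
open import Data.Fin as Fin using (Fin; toℕ; _≟_)
import Data.Fin.Properties as Fin
open import Data.List using (List; []; _∷_; _++_; _∷ʳ_; take; drop; lookup; length)
open import Data.List.Properties using (++-assoc; ++-identityʳ; take-suc; tabulate-lookup)
open import Data.List.Membership.Propositional using (_∈_; _∉_)
open import Data.List.Membership.Propositional.Properties using (∈-++⁺ʳ; ∈-++⁻; ∈-lookup)
open import Data.List.Relation.Unary.Any using (here; there)
open import Data.List.Relation.Unary.All as All using (All; []; _∷_)
import Data.List.Relation.Unary.All.Properties as All
open import Data.List.Relation.Unary.AllPairs as AllPairs using (AllPairs; []; _∷_)
open import Data.List.Relation.Unary.Unique.Propositional using (Unique)
import Data.List.Relation.Unary.AllPairs.Properties as AllPairs
open import Data.List.Relation.Binary.Permutation.Propositional using (_↭_; ↭-trans; ↭-sym; ↭-reflexive)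
open import Data.List.Relation.Binary.Permutation.Propositional.Properties using (∈-resp-↭; ∷↭∷ʳ)
open import Data.Sum using (_⊎_; inj₁; inj₂)
open import Data.Product using (_×_; _,_; proj₁; proj₂)
open import Data.Unit using (⊤; tt)
open import Data.Empty using (⊥-elim)
open import Function using (flip; _∘′_)
open import Relation.Binary.Definitions using (Asymmetric; tri<; tri≈; tri>)
open import Relation.Binary.PropositionalEquality
open import Relation.Nullary using (¬_; yes; no)
open import Relation.Nullary.Decidable using (toSum)

0≤i+j : ∀ {i j} → 0ℤ ≤ i → 0ℤ ≤ j → 0ℤ ≤ i + j
0≤i+j = +-mono-≤

0≤i*j : ∀ {i j} → 0ℤ ≤ i → 0ℤ ≤ j → 0ℤ ≤ i * j
0≤i*j (+≤+ {n = m} _) (+≤+ {n = n} _) = subst (0ℤ ≤_) (pos-* m n) (+≤+ ℕ.z≤n)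

0<i⇒0≤i-1 : ∀ {i} → 0ℤ < i → 0ℤ ≤ i - 1ℤ
0<i⇒0≤i-1 = i≤j⇒0≤j-i ∘′ i<j⇒suc[i]≤j

2≤i⇒0<i : ∀ {i} → + 2 ≤ i → 0ℤ < i
2≤i⇒0<i = <-≤-trans (+<+ (ℕ.s≤s ℕ.z≤n))

0<i+j : ∀ {i j} → 0ℤ < i → + 2 ≤ j → 0ℤ < i + j
0<i+j 0<i 2≤j = +-mono-<-≤ 0<i (<⇒≤ (2≤i⇒0<i 2≤j))

0<-by-gap : ∀ {i} d → 0ℤ ≤ d → i ≡ 1ℤ + d → 0ℤ < i
0<-by-gap d 0≤d refl = suc[i]≤j⇒i<j (+-monoʳ-≤ 1ℤ 0≤d)

<⇒0<-i+j : ∀ {i j} → i < j → 0ℤ < - i + j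
<⇒0<-i+j {i} {j} i<j = subst (_< - i + j) (+-inverseˡ i) (+-monoʳ-< (- i) i<j)

0<a+x*e : ∀ a x e → 0ℤ < x → 0ℤ ≤ e → 0ℤ < a + e → 0ℤ < a + x * e
0<a+x*e a x e 0<x 0≤e 0<a+e =
  0<-by-gap ((a + e - 1ℤ) + (x - 1ℤ) * e)
    (0≤i+j (0<i⇒0≤i-1 0<a+e) (0≤i*j (0<i⇒0≤i-1 0<x) 0≤e))
    (identity a x e)
  where
  identity : ∀ a x e → a + x * e ≡ 1ℤ + ((a + e - 1ℤ) + (x - 1ℤ) * e)
  identity = solve-∀

-- With x = p + 1, e = q + 2 and a + e = u + 1, the right-hand side minus one is a
-- polynomial in p, q, u, e ≥ 0 with nonnegative coefficients.
0<-x+[a+x*e]*e : ∀ a x e → 0ℤ < x → + 2 ≤ e → 0ℤ < a + e → 0ℤ < - x + (a + x * e) * e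
0<-x+[a+x*e]*e a x e 0<x 2≤e 0<a+e =
  0<-by-gap (u * e + q + p * q * q + + 4 * p * q + + 3 * p)
    (0≤i+j (0≤i+j (0≤i+j (0≤i+j (0≤i*j 0≤u 0≤e) 0≤q) (0≤i*j (0≤i*j 0≤p 0≤q) 0≤q))
      (0≤i*j (0≤i*j (nonNegative⁻¹ (+ 4)) 0≤p) 0≤q)) (0≤i*j (nonNegative⁻¹ (+ 3)) 0≤p))
    (identity a x e)
  where
  u p q : ℤ
  u = a + e - 1ℤ
  p = x - 1ℤ
  q = e - + 2
  0≤u : 0ℤ ≤ u
  0≤u = 0<i⇒0≤i-1 0<a+e
  0≤p : 0ℤ ≤ p
  0≤p = 0<i⇒0≤i-1 0<x
  0≤q : 0ℤ ≤ q
  0≤q = i≤j⇒0≤j-i 2≤e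
  0≤e : 0ℤ ≤ e
  0≤e = ≤-trans (+≤+ ℕ.z≤n) 2≤e
  identity : ∀ a x e → - x + (a + x * e) * e ≡
    1ℤ + ((a + e - 1ℤ) * e + (e - + 2) + (x - 1ℤ) * (e - + 2) * (e - + 2)
          + + 4 * (x - 1ℤ) * (e - + 2) + + 3 * (x - 1ℤ))
  identity = solve-∀

module _ {N : ℕ} where

  Arrow : Quiver N → Fin N → Fin N → Set
  Arrow G a b = 0ℤ < G a b

  TwoArrows : Quiver N → Fin N → Fin N → Set
  TwoArrows G a b = + 2 ≤ G a b

  module _ {G : Quiver N} (isQuiver : IsQuiver G) where

    skew : ∀ a b → G b a ≡ - G a b
    skew a b = isQuiver b a

    arrow⇒≢ : ∀ {a b} → Arrow G a b → a ≢ b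
    arrow⇒≢ {a} 0<Gaa refl = <-irrefl (sym Gaa≡0) 0<Gaa
      where
      i≡-i⇒i≡0 : ∀ {i} → i ≡ - i → i ≡ 0ℤ
      i≡-i⇒i≡0 {+ 0} _ = refl
      i≡-i⇒i≡0 {+[1+ n ]} ()
      i≡-i⇒i≡0 { -[1+ n ]} ()
      Gaa≡0 : G a a ≡ 0ℤ
      Gaa≡0 = i≡-i⇒i≡0 (isQuiver a a)

    arrow-asym : Asymmetric (Arrow G)
    arrow-asym {a} {b} 0<Gab 0<Gba =
      <-asym (subst (0ℤ <_) (skew a b) 0<Gba) (neg-mono-< 0<Gab)

    arrow⇒reverse-nonPos : ∀ {a b} → Arrow G a b → G b a ≤ 0ℤ
    arrow⇒reverse-nonPos {a} {b} 0<Gab = subst (_≤ 0ℤ) (sym (skew a b)) (neg-mono-≤ (<⇒≤ 0<Gab))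

    twoArrows-total : Abundant G → ∀ {a b} → a ≢ b → TwoArrows G a b ⊎ TwoArrows G b a
    twoArrows-total abundant {a} {b} a≢b with G a b | skew a b | abundant a b a≢b
    ... | + n      | _     | 2≤n = inj₁ (+≤+ 2≤n)
    ... | -[1+ n ] | Gba≡ | 2≤n = inj₂ (subst (+ 2 ≤_) (sym Gba≡) (+≤+ 2≤n))

  module _ (k : Fin N) (G : Quiver N) where
    open ≡-Reasoning

    μ-into : ∀ {a} → a ≢ k → μ k G a k ≡ - G a k
    μ-into {a} a≢k with a ≟ k | k ≟ k
    ... | yes a≡k | _      = ⊥-elim (a≢k a≡k)
    ... | no _    | yes _  = refl
    ... | no _    | no k≢k = ⊥-elim (k≢k refl)

    μ-out : ∀ b → μ k G k b ≡ - G k b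
    μ-out b with k ≟ k
    ... | yes _  = refl
    ... | no k≢k = ⊥-elim (k≢k refl)

    μ-away : ∀ {a b} → a ≢ k → b ≢ k →
             μ k G a b ≡ G a b + pos (G a k) * pos (G k b) - pos (G b k) * pos (G k a)
    μ-away {a} {b} a≢k b≢k with a ≟ k | b ≟ k
    ... | yes a≡k | _       = ⊥-elim (a≢k a≡k)
    ... | no _    | yes b≡k = ⊥-elim (b≢k b≡k)
    ... | no _    | no _    = refl

    μ-isQuiver : IsQuiver G → IsQuiver (μ k G)
    μ-isQuiver isQuiver a b with toSum (a ≟ k) | toSum (b ≟ k)
    ... | inj₁ refl | inj₁ refl = begin
      μ k G k k   ≡⟨ μ-out k ⟩
      - G k k     ≡⟨ cong -_ (isQuiver k k) ⟩
      - (- G k k) ≡⟨ cong -_ (μ-out k) ⟨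
      - μ k G k k ∎
    ... | inj₁ refl | inj₂ b≢k = begin
      μ k G k b   ≡⟨ μ-out b ⟩
      - G k b     ≡⟨ cong -_ (isQuiver k b) ⟩
      - (- G b k) ≡⟨ cong -_ (μ-into b≢k) ⟨
      - μ k G b k ∎
    ... | inj₂ a≢k | inj₁ refl = begin
      μ k G a k   ≡⟨ μ-into a≢k ⟩
      - G a k     ≡⟨ cong -_ (isQuiver a k) ⟩
      - (- G k a) ≡⟨ cong -_ (μ-out a) ⟨
      - μ k G k a ∎
    ... | inj₂ a≢k | inj₂ b≢k = begin
      μ k G a b                 ≡⟨ μ-away a≢k b≢k ⟩
      G a b + P - Q             ≡⟨ cong (λ g → g + P - Q) (isQuiver a b) ⟩
      - G b a + P - Q           ≡⟨ neg-swap (G b a) P Q ⟩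
      - (G b a + Q - P)         ≡⟨ cong -_ (μ-away b≢k a≢k) ⟨
      - μ k G b a               ∎
      where
      P Q : ℤ
      P = pos (G a k) * pos (G k b)
      Q = pos (G b k) * pos (G k a)
      neg-swap : ∀ g p q → - g + p - q ≡ - (g + q - p)
      neg-swap = solve-∀

  pos-nonNeg : ∀ {i} → 0ℤ ≤ i → pos i ≡ i
  pos-nonNeg = i≥j⇒i⊔j≡i

  pos-nonPos : ∀ {i} → i ≤ 0ℤ → pos i ≡ 0ℤ
  pos-nonPos = i≤j⇒i⊔j≡j

  module _ {G : Quiver N} (isQuiver : IsQuiver G) {k : Fin N} where
    open ≡-Reasoning

    μ-reverses-into : ∀ {a} → a ≢ k → μ k G a k ≡ G k a
    μ-reverses-into {a} a≢k = trans (μ-into k G a≢k) (sym (skew isQuiver a k))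

    μ-between-out-neighbours : ∀ {a b} → Arrow G k a → Arrow G k b → μ k G a b ≡ G a b
    μ-between-out-neighbours {a} {b} k→a k→b = begin
      μ k G a b                                                ≡⟨ μ-away k G a≢k b≢k ⟩
      G a b + pos (G a k) * pos (G k b) - pos (G b k) * pos (G k a)
        ≡⟨ cong₂ (λ s t → G a b + s * pos (G k b) - t * pos (G k a))
                 (pos-nonPos (arrow⇒reverse-nonPos isQuiver k→a))
                 (pos-nonPos (arrow⇒reverse-nonPos isQuiver k→b)) ⟩
      G a b + 0ℤ * pos (G k b) - 0ℤ * pos (G k a)
        ≡⟨ drop-zeros (G a b) (pos (G k b)) (pos (G k a)) ⟩
      G a b                                                    ∎
      where
      a≢k : a ≢ k
      a≢k = arrow⇒≢ isQuiver k→a ∘′ sym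
      b≢k : b ≢ k
      b≢k = arrow⇒≢ isQuiver k→b ∘′ sym
      drop-zeros : ∀ g s t → g + 0ℤ * s - 0ℤ * t ≡ g
      drop-zeros = solve-∀

    μ-through : ∀ {r y} → Arrow G r k → Arrow G k y → μ k G r y ≡ G r y + G r k * G k y
    μ-through {r} {y} r→k k→y = begin
      μ k G r y                                                ≡⟨ μ-away k G r≢k y≢k ⟩
      G r y + pos (G r k) * pos (G k y) - pos (G y k) * pos (G k r)
        ≡⟨ cong₂ (λ s t → G r y + s - t * pos (G k r))
                 (cong₂ _*_ (pos-nonNeg (<⇒≤ r→k)) (pos-nonNeg (<⇒≤ k→y)))
                 (pos-nonPos (arrow⇒reverse-nonPos isQuiver k→y)) ⟩
      G r y + G r k * G k y - 0ℤ * pos (G k r)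
        ≡⟨ drop-zero (G r y + G r k * G k y) (pos (G k r)) ⟩
      G r y + G r k * G k y                                    ∎
      where
      r≢k : r ≢ k
      r≢k = arrow⇒≢ isQuiver r→k
      y≢k : y ≢ k
      y≢k = arrow⇒≢ isQuiver k→y ∘′ sym
      drop-zero : ∀ g t → g - 0ℤ * t ≡ g
      drop-zero = solve-∀

  module _ {G : Quiver N} (isQuiver : IsQuiver G) {r k y : Fin N}
           (r→k : Arrow G r k) (k⇉y : TwoArrows G k y) (0<Gry+Gky : 0ℤ < G r y + G k y) where

    private
      k→y : Arrow G k y
      k→y = 2≤i⇒0<i k⇉y

    arrow-after-μ : Arrow (μ k G) r y
    arrow-after-μ = subst (0ℤ <_) (sym (μ-through isQuiver r→k k→y))
      (0<a+x*e (G r y) (G r k) (G k y) r→k (<⇒≤ k→y) 0<Gry+Gky)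

    arrow-after-second-μ : Arrow (μ y (μ k G)) r k
    arrow-after-second-μ = subst (0ℤ <_) (sym μμGrk≡)
      (0<-x+[a+x*e]*e (G r y) (G r k) (G k y) r→k k⇉y 0<Gry+Gky)
      where
      open ≡-Reasoning
      G′ : Quiver N
      G′ = μ k G
      y→k : Arrow G′ y k
      y→k = subst (0ℤ <_) (sym (μ-reverses-into isQuiver {k} (arrow⇒≢ isQuiver k→y ∘′ sym))) k→y
      μμGrk≡ : μ y G′ r k ≡ - G r k + (G r y + G r k * G k y) * G k y
      μμGrk≡ = begin
        μ y G′ r k                  ≡⟨ μ-through (μ-isQuiver k G isQuiver) {y} {r} {k} arrow-after-μ y→k ⟩
        G′ r k + G′ r y * G′ y k    ≡⟨ cong₂ (λ s t → s + t * G′ y k) (μ-into k G (arrow⇒≢ isQuiver r→k))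
                                             (μ-through isQuiver r→k k→y) ⟩
        - G r k + (G r y + G r k * G k y) * G′ y k
                                    ≡⟨ cong (λ t → - G r k + (G r y + G r k * G k y) * t)
                                            (μ-reverses-into isQuiver {k} (arrow⇒≢ isQuiver k→y ∘′ sym)) ⟩
        - G r k + (G r y + G r k * G k y) * G k y ∎

module _ {A : Set} where

  AllPairs⇒lookup : ∀ {R : A → A → Set} {xs} → AllPairs R xs →
                    ∀ {p q} → p Fin.< q → R (lookup xs p) (lookup xs q)
  AllPairs⇒lookup (h ∷ _)  {Fin.zero}  {Fin.suc q} _           = All.lookup h (∈-lookup q)
  AllPairs⇒lookup (_ ∷ hs) {Fin.suc p} {Fin.suc q} (ℕ.s≤s p<q) = AllPairs⇒lookup hs p<q

  lookup⇒AllPairs : ∀ {R : A → A → Set} xs →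
                    (∀ {p q} → p Fin.< q → R (lookup xs p) (lookup xs q)) → AllPairs R xs
  lookup⇒AllPairs xs h = subst (AllPairs _) (tabulate-lookup xs) (AllPairs.tabulate⁺-< h)

  AllPairs-map-All : ∀ {P : A → Set} {R R′ : A → A → Set} → (∀ {a b} → P a → P b → R a b → R′ a b) →
                     ∀ {xs} → All P xs → AllPairs R xs → AllPairs R′ xs
  AllPairs-map-All f []         []       = []
  AllPairs-map-All f (pa ∷ pxs) (h ∷ hs) =
    All.zipWith (λ (pb , Rab) → f pa pb Rab) (pxs , h) ∷ AllPairs-map-All f pxs hs

  AllPairs-∷ʳ⁻ : ∀ {R : A → A → Set} xs {y} → AllPairs R (xs ∷ʳ y) → AllPairs R xs × All (flip R y) xs
  AllPairs-∷ʳ⁻ []       _        = [] , []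
  AllPairs-∷ʳ⁻ (x ∷ xs) (h ∷ hs) with All.∷ʳ⁻ h | AllPairs-∷ʳ⁻ xs hs
  ... | hxs , Rxy | hs′ , Rxsy = hxs ∷ hs′ , Rxy ∷ Rxsy

  AllPairs-total : ∀ {R : A → A → Set} {xs a b} → AllPairs R xs →
                   a ∈ xs → b ∈ xs → a ≢ b → R a b ⊎ R b a
  AllPairs-total (_ ∷ _)  (here refl) (here refl) a≢b = ⊥-elim (a≢b refl)
  AllPairs-total (h ∷ _)  (here refl) (there b∈) _   = inj₁ (All.lookup h b∈)
  AllPairs-total (h ∷ _)  (there a∈)  (here refl) _   = inj₂ (All.lookup h a∈)
  AllPairs-total (_ ∷ hs) (there a∈)  (there b∈)  a≢b = AllPairs-total hs a∈ b∈ a≢b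

  ordered⇒AllPairs : ∀ {R : A → A → Set} {xs} → Unique xs →
    (∀ {a b} → a ∈ xs → b ∈ xs → a ≢ b → R a b ⊎ R b a) →
    (∀ p q → R (lookup xs p) (lookup xs q) → p Fin.< q) → AllPairs R xs
  ordered⇒AllPairs {R} {xs} unique total ordered = lookup⇒AllPairs xs forward
    where
    forward : ∀ {p q} → p Fin.< q → R (lookup xs p) (lookup xs q)
    forward {p} {q} p<q with total (∈-lookup p) (∈-lookup q) (AllPairs⇒lookup unique p<q)
    ... | inj₁ Rpq = Rpq
    ... | inj₂ Rqp = ⊥-elim (Fin.<-asym p<q (ordered q p Rqp))

  module _ {R : A → A → Set} (asym : Asymmetric R) where

    private
      ∈-tail : ∀ {x xs ys} → All (R x) xs → (∀ {z} → z ∈ xs → z ∈ x ∷ ys) → ∀ {z} → z ∈ xs → z ∈ ys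
      ∈-tail Rx sub z∈ with sub z∈
      ... | here refl = ⊥-elim (asym Rxz Rxz) where Rxz = All.lookup Rx z∈
      ... | there z∈ys = z∈ys

      heads-≡ : ∀ {x y xs ys} → All (R x) xs → All (R y) ys → x ∈ y ∷ ys → y ∈ x ∷ xs → x ≡ y
      heads-≡ _  _  (here x≡y)   _            = x≡y
      heads-≡ _  _  (there _)    (here y≡x)   = sym y≡x
      heads-≡ Rx Ry (there x∈ys) (there y∈xs) = ⊥-elim (asym (All.lookup Rx y∈xs) (All.lookup Ry x∈ys))

    AllPairs-≡ : ∀ {xs ys} → AllPairs R xs → AllPairs R ys →
      (∀ {z} → z ∈ xs → z ∈ ys) → (∀ {z} → z ∈ ys → z ∈ xs) → xs ≡ ys
    AllPairs-≡ []       []         _   _   = refl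
    AllPairs-≡ []       (_ ∷ _)    _   sup with () ← sup (here refl)
    AllPairs-≡ (_ ∷ _)  []         sub _   with () ← sub (here refl)
    AllPairs-≡ (h ∷ hs) (h′ ∷ hs′) sub sup with heads-≡ h h′ (sub (here refl)) (sup (here refl))
    ... | refl = cong (_ ∷_) (AllPairs-≡ hs hs′ (∈-tail h (sub ∘′ there)) (∈-tail h′ (sup ∘′ there)))

module _ {N : ℕ} where

  Enumerates : Fin N → List (Fin N) → Set
  Enumerates x xs = (∀ y → y ∈ xs → y ≢ x) × (∀ y → y ≢ x → y ∈ xs)

  Enumerates-resp-↭ : ∀ {x xs ys} → xs ↭ ys → Enumerates x xs → Enumerates x ys
  Enumerates-resp-↭ xs↭ys (avoids , covers) =
    (λ y y∈ys → avoids y (∈-resp-↭ (↭-sym xs↭ys) y∈ys)) , (λ y y≢x → ∈-resp-↭ xs↭ys (covers y y≢x))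

  Enumerates-swap : ∀ {r w xs} → Enumerates r (xs ∷ʳ w) → w ∉ xs → Enumerates w (r ∷ xs)
  Enumerates-swap {r} {w} {xs} (avoids , covers) w∉xs = avoids′ , covers′
    where
    avoids′ : ∀ y → y ∈ r ∷ xs → y ≢ w
    avoids′ y (here refl) r≡w = avoids w (∈-++⁺ʳ xs (here refl)) (sym r≡w)
    avoids′ y (there y∈xs) refl = w∉xs y∈xs
    covers′ : ∀ y → y ≢ w → y ∈ r ∷ xs
    covers′ y y≢w with toSum (y ≟ r)
    ... | inj₁ refl = here refl
    ... | inj₂ y≢r with ∈-++⁻ xs (covers y y≢r)
    ...   | inj₁ y∈xs       = there y∈xs
    ...   | inj₂ (here y≡w) = ⊥-elim (y≢w y≡w)

  chain⇒isUniqueAcyclicOrdering : ∀ {G x xs} → IsQuiver G → AllPairs (Arrow G) xs → Enumerates x xs →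
                                  IsUniqueAcyclicOrdering G x xs
  chain⇒isUniqueAcyclicOrdering {G} {x} {xs} isQuiver chain (avoids , covers) =
    (AllPairs.map (arrow⇒≢ isQuiver) chain , avoids , covers , ordered) , uniqueness
    where
    ordered : ∀ p q → Arrow G (lookup xs p) (lookup xs q) → p Fin.< q
    ordered p q p→q with Fin.<-cmp p q
    ... | tri< p<q _ _ = p<q
    ... | tri≈ _ refl _ = ⊥-elim (arrow⇒≢ isQuiver p→q refl)
    ... | tri> _ _ q<p = ⊥-elim (arrow-asym isQuiver (AllPairs⇒lookup chain q<p) p→q)
    uniqueness : ∀ ys → IsAcyclicOrdering G x ys → ys ≡ xs
    uniqueness ys (unique′ , avoids′ , covers′ , ordered′) =
      AllPairs-≡ (arrow-asym isQuiver) chain′ chain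
        (λ {z} z∈ys → covers z (avoids′ z z∈ys)) (λ {z} z∈xs → covers′ z (avoids z z∈xs))
      where
      chain′ : AllPairs (Arrow G) ys
      chain′ = ordered⇒AllPairs unique′
        (λ {a} {b} a∈ b∈ → AllPairs-total chain (covers a (avoids′ a a∈)) (covers b (avoids′ b b∈)))
        ordered′

  μ-source-chain : ∀ {G : Quiver N} {k xs} → IsQuiver G → AllPairs (TwoArrows G) (k ∷ xs) →
                   AllPairs (TwoArrows (μ k G)) (xs ∷ʳ k)
  μ-source-chain {G} {k} isQuiver (k⇉xs ∷ chain) =
    AllPairs.++⁺ (AllPairs-map-All unchanged k⇉xs chain) ([] ∷ [])
                 (All.map (λ k⇉a → reversed k⇉a ∷ []) k⇉xs)
    where
    unchanged : ∀ {a b} → TwoArrows G k a → TwoArrows G k b → TwoArrows G a b → TwoArrows (μ k G) a b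
    unchanged k⇉a k⇉b =
      subst (+ 2 ≤_) (sym (μ-between-out-neighbours isQuiver (2≤i⇒0<i k⇉a) (2≤i⇒0<i k⇉b)))
    reversed : ∀ {a} → TwoArrows G k a → TwoArrows (μ k G) a k
    reversed k⇉a =
      subst (+ 2 ≤_) (sym (μ-reverses-into isQuiver (arrow⇒≢ isQuiver (2≤i⇒0<i k⇉a) ∘′ sym))) k⇉a

  ∖-away : ∀ (f : Quiver N) {r a b} → a ≢ r → b ≢ r → (f ∖ r) a b ≡ f a b
  ∖-away f {r} {a} {b} a≢r b≢r with a ≟ r | b ≟ r
  ... | yes a≡r | _       = ⊥-elim (a≢r a≡r)
  ... | no _    | yes b≡r = ⊥-elim (b≢r b≡r)
  ... | no _    | no _    = refl

  module _ {f : Quiver N} {r : Fin N} (sink : ∀ y → ¬ Arrow f r y) where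

    path-source-≢-sink : ∀ {a b} → Path f a b → a ≢ r
    path-source-≢-sink (edge a→b)   refl = sink _ a→b
    path-source-≢-sink (step a→c _) refl = sink _ a→c

    path-avoids-sink : ∀ {a b} → Path f a b → b ≢ r → Path (f ∖ r) a b
    path-avoids-sink path@(edge a→b) b≢r =
      edge (subst (0ℤ <_) (sym (∖-away f (path-source-≢-sink path) b≢r)) a→b)
    path-avoids-sink path@(step a→c rest) b≢r =
      step (subst (0ℤ <_) (sym (∖-away f (path-source-≢-sink path) (path-source-≢-sink rest))) a→c)
           (path-avoids-sink rest b≢r)

    sink⇒acyclic : Acyclic (f ∖ r) → Acyclic f
    sink⇒acyclic acyclic (a , cycle) = acyclic (a , path-avoids-sink cycle (path-source-≢-sink cycle))

module _ {N : ℕ} (r : Fin N) where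

  NextMutationReverses : Quiver N → Fin N → List (Fin N) → Set
  NextMutationReverses G w []      = ⊤
  NextMutationReverses G w (k ∷ _) = Arrow (μ k G) r w

  -- The quiver after mutating along P ∷ʳ w, with L still to be mutated.
  record Stage (G : Quiver N) (w : Fin N) (L P : List (Fin N)) : Set where
    field
      isQuiver   : IsQuiver G
      chain      : AllPairs (TwoArrows G) (L ++ P ∷ʳ w)
      from-r     : All (Arrow G r) (L ++ P)
      next       : NextMutationReverses G w L
      enumerates : Enumerates r (L ++ P ∷ʳ w)

  private
    All-init : ∀ {Q : Fin N → Set} L P {w} → All Q (L ++ P ∷ʳ w) → All Q (L ++ P)
    All-init L P {w} = proj₁ ∘′ All.∷ʳ⁻ ∘′ subst (All _) (sym (++-assoc L P (w ∷ [])))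

  Stage-step : ∀ {G w k L P} → Stage G w (k ∷ L) P → Stage (μ k G) k L (P ∷ʳ w)
  Stage-step {G} {w} {k} {L} {P} s = record
    { isQuiver   = μ-isQuiver k G isQuiver
    ; chain      = subst (AllPairs _) reassoc (μ-source-chain isQuiver chain)
    ; from-r     = subst (All _) (++-assoc L P (w ∷ []))
                     (All.∷ʳ⁺ (All.zipWith arrow-after-μ′ (All.tail from-r , All-init L P k⇉)) next)
    ; next       = next′ L k⇉ (All.tail from-r)
    ; enumerates = Enumerates-resp-↭ (↭-trans (∷↭∷ʳ k (L ++ P ∷ʳ w)) (↭-reflexive reassoc)) enumerates
    }
    where
    open Stage s
    reassoc : (L ++ P ∷ʳ w) ∷ʳ k ≡ L ++ (P ∷ʳ w) ∷ʳ k
    reassoc = ++-assoc L (P ∷ʳ w) (k ∷ [])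
    r→k : Arrow G r k
    r→k = All.head from-r
    k⇉ : All (TwoArrows G k) (L ++ P ∷ʳ w)
    k⇉ = AllPairs.head chain
    arrow-after-μ′ : ∀ {y} → Arrow G r y × TwoArrows G k y → Arrow (μ k G) r y
    arrow-after-μ′ (r→y , k⇉y) = arrow-after-μ isQuiver r→k k⇉y (0<i+j r→y k⇉y)
    next′ : ∀ L → All (TwoArrows G k) (L ++ P ∷ʳ w) → All (Arrow G r) (L ++ P) →
            NextMutationReverses (μ k G) k L
    next′ []      _           _          = tt
    next′ (_ ∷ _) (k⇉k′ ∷ _) (r→k′ ∷ _) = arrow-after-second-μ isQuiver r→k k⇉k′ (0<i+j r→k′ k⇉k′)

  Stage⇒orderings : ∀ {G w L P} → Stage G w L P →
    IsUniqueAcyclicOrdering G w (r ∷ L ++ P) × IsUniqueAcyclicOrdering G r (L ++ P ∷ʳ w)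
  Stage⇒orderings {G} {w} {L} {P} s =
    chain⇒isUniqueAcyclicOrdering isQuiver (from-r ∷ AllPairs.map 2≤i⇒0<i chain-init)
      (Enumerates-swap (subst (Enumerates r) (sym reassoc) enumerates) w∉LP) ,
    chain⇒isUniqueAcyclicOrdering isQuiver (AllPairs.map 2≤i⇒0<i chain) enumerates
    where
    open Stage s
    reassoc : (L ++ P) ∷ʳ w ≡ L ++ P ∷ʳ w
    reassoc = ++-assoc L P (w ∷ [])
    split : AllPairs (TwoArrows G) (L ++ P) × All (flip (TwoArrows G) w) (L ++ P)
    split = AllPairs-∷ʳ⁻ (L ++ P) (subst (AllPairs _) (sym reassoc) chain)
    chain-init : AllPairs (TwoArrows G) (L ++ P)
    chain-init = proj₁ split
    w∉LP : w ∉ L ++ P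
    w∉LP w∈ = arrow⇒≢ isQuiver (2≤i⇒0<i (All.lookup (proj₂ split) w∈)) refl

  Stage-iterate : ∀ {G w L P} → Stage G w L P → (j : Fin (suc (length L))) →
    Stage (μs (take (toℕ j) L) G) (lookup (w ∷ L) j) (drop (toℕ j) L) (P ++ take (toℕ j) (w ∷ L))
  Stage-iterate {P = P} s Fin.zero = subst (Stage _ _ _) (sym (++-identityʳ P)) s
  Stage-iterate {w = w} {k ∷ L} {P} s (Fin.suc j) =
    subst (Stage _ _ _) (++-assoc P (w ∷ []) (take (toℕ j) (k ∷ L))) (Stage-iterate (Stage-step s) j)

abundant-ordering⇒chain : ∀ {N} {f : Quiver N} {x v} → IsQuiver f → Abundant f → IsAcyclicOrdering f x v →
                          AllPairs (TwoArrows f) v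
abundant-ordering⇒chain isQuiver abundant (unique , _ , _ , ordered) =
  ordered⇒AllPairs unique (λ _ _ → twoArrows-total isQuiver abundant) (λ p q → ordered p q ∘′ 2≤i⇒0<i)

module _ {N : ℕ} {f : Quiver N} {r v₀ : Fin N} {vs : List (Fin N)}
         (isQuiver : IsQuiver f) (abundant : Abundant f)
         (returns : ∀ i j → 0ℤ < f i r → 0ℤ < f r j → (f i r < f j i) × (f r j < f j i))
         (chain : AllPairs (TwoArrows f) (v₀ ∷ vs)) (enumerates : Enumerates r (v₀ ∷ vs)) where

  private
    v₀⇉ : All (TwoArrows f v₀) vs
    v₀⇉ = AllPairs.head chain

  r→source : ¬ Acyclic f → Acyclic (f ∖ r) → Arrow f r v₀
  r→source cyclic acyclic with 0ℤ <? f r v₀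
  ... | yes r→v₀ = r→v₀
  ... | no ¬r→v₀ = ⊥-elim (cyclic (sink⇒acyclic sink acyclic))
    where
    v₀→r : Arrow f v₀ r
    v₀→r with twoArrows-total isQuiver abundant (proj₁ enumerates v₀ (here refl) ∘′ sym)
    ... | inj₁ r⇉v₀ = ⊥-elim (¬r→v₀ (2≤i⇒0<i r⇉v₀))
    ... | inj₂ v₀⇉r = 2≤i⇒0<i v₀⇉r
    sink : ∀ y → ¬ Arrow f r y
    sink y r→y with proj₂ enumerates y (arrow⇒≢ isQuiver r→y ∘′ sym)
    ... | here refl  = ¬r→v₀ r→y
    ... | there y∈vs = arrow-asym isQuiver (2≤i⇒0<i (All.lookup v₀⇉ y∈vs))
                         (<-trans v₀→r (proj₁ (returns v₀ y v₀→r r→y)))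

  module _ (r→v₀ : Arrow f r v₀) where

    0<fry+fv₀y : ∀ {y} → y ∈ vs → 0ℤ < f r y + f v₀ y
    0<fry+fv₀y {y} y∈vs with 0ℤ <? f r y
    ... | yes r→y = 0<i+j r→y (All.lookup v₀⇉ y∈vs)
    ... | no ¬r→y with twoArrows-total isQuiver abundant (proj₁ enumerates y (there y∈vs) ∘′ sym)
    ...   | inj₁ r⇉y = ⊥-elim (¬r→y (2≤i⇒0<i r⇉y))
    ...   | inj₂ y⇉r = subst (λ i → 0ℤ < i + f v₀ y) (sym (skew isQuiver y r))
                         (<⇒0<-i+j (proj₁ (returns y v₀ (2≤i⇒0<i y⇉r) r→v₀)))

    initial-stage : Stage r (μ v₀ f) v₀ vs []
    initial-stage = record
      { isQuiver   = μ-isQuiver v₀ f isQuiver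
      ; chain      = μ-source-chain isQuiver chain
      ; from-r     = subst (All _) (sym (++-identityʳ vs))
                       (All.tabulate (λ y∈vs →
                          arrow-after-μ isQuiver r→v₀ (All.lookup v₀⇉ y∈vs) (0<fry+fv₀y y∈vs)))
      ; next       = next vs v₀⇉ 0<fry+fv₀y
      ; enumerates = Enumerates-resp-↭ (∷↭∷ʳ v₀ vs) enumerates
      }
      where
      next : ∀ L → All (TwoArrows f v₀) L → (∀ {y} → y ∈ L → 0ℤ < f r y + f v₀ y) →
             NextMutationReverses r (μ v₀ f) v₀ L
      next []      _          _   = tt
      next (_ ∷ _) (v₀⇉k ∷ _) 0<s = arrow-after-second-μ isQuiver r→v₀ v₀⇉k (0<s (here refl))

lemma3p5 : (N : ℕ) (f : Quiver N) (r : Fin N) (v : List (Fin N)) →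
    IsFork f r →
    IsUniqueAcyclicOrdering f r v →
    (j : Fin (length v)) →
      IsUniqueAcyclicOrdering (μs (take (suc (toℕ j)) v) f) (lookup v j)
        (r ∷ (drop (suc (toℕ j)) v ++ take (toℕ j) v))
      × IsUniqueAcyclicOrdering (μs (take (suc (toℕ j)) v) f) r
        (drop (suc (toℕ j)) v ++ take (suc (toℕ j)) v)
lemma3p5 N f r [] _ _ ()
lemma3p5 N f r v@(v₀ ∷ vs) (isQuiver , abundant , cyclic , returns , acyclic) (ordering , _) j =
  proj₁ orderings ,
  subst (IsUniqueAcyclicOrdering F′ r) (cong (drop (suc (toℕ j)) v ++_) (sym (take-suc v j))) (proj₂ orderings)
  where
  chain : AllPairs (TwoArrows f) v
  chain = abundant-ordering⇒chain isQuiver abundant ordering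
  enumerates : Enumerates r v
  enumerates = proj₁ (proj₂ ordering) , proj₁ (proj₂ (proj₂ ordering))
  r→v₀ : Arrow f r v₀
  r→v₀ = r→source isQuiver abundant returns chain enumerates cyclic acyclic
  stage : Stage r (μ v₀ f) v₀ vs []
  stage = initial-stage isQuiver abundant returns chain enumerates r→v₀
  F′ : Quiver N
  F′ = μs (take (suc (toℕ j)) v) f
  orderings : IsUniqueAcyclicOrdering F′ (lookup v j) (r ∷ drop (suc (toℕ j)) v ++ take (toℕ j) v)
            × IsUniqueAcyclicOrdering F′ r (drop (suc (toℕ j)) v ++ take (toℕ j) v ∷ʳ lookup v j)
  orderings = Stage⇒orderings r (Stage-iterate r stage j)
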